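{- For all $k_1,k_2\in\mathbb{N}$ with $k_1+k_2\geq 1$ and every colored graph $G$, \[\operatorname{owl}^{(\infty)}_{(k_1,k_2)}(G)\equiv\bigl(\operatorname{owl\text{ - }ref}^{(\infty)}_{(k_1,0)}\circ\operatorname{owl\text{ - }ref}_{(0,k_2)}\bigr)^{(k_2)}\bigl(\operatorname{owl}^{(\infty)}_{(k_1,0)}(G)\bigr),\] where the exponent $(k_2)$ denotes $k_2$-fold composition.
   Context: Let $[x_{k_1}]=\{x_1,\dots,x_{k_1}\}$, $[y_{k_2}]=\{y_1,\dots,y_{k_2}\}$. Let $\mathcal{A}$ be the set of partial assignments $\alpha\colon[x_{k_1}]\cup[y_{k_2}]\rightharpoonup V(G)$ (equivalently tuples $\overline\alpha$ over $V(G)\cup\{\bot\}$, $\bot$ meaning undefined); $\alpha[z/w]$ is $\alpha$ with value at $z$ set to $w$, and $J(\alpha)=\{j\in[k_2]:\alpha(y_j)=\bot\}$. The atomic type $\operatorname{atp}_{k_1+k_2}(G,\overline\alpha)$ is the set of atomic formulas ($z=z'$, $E(z,z')$, $U_c(z)$) with variables in $\operatorname{dom}\alpha$ satisfied in $G$ under $\alpha$. For a coloring $\chi$ of $\mathcal{A}$ define $\operatorname{owl\text{ - }ref}_{(k_1,k_2)}(\chi)(\alpha)=\bigl(\chi(\alpha),(\{\!\!\{\chi(\alpha[x_i/w]):w\in V(G)\}\!\!\})_{i\in[k_1]},(\{\!\!\{\chi(\alpha[y_j/w]):w\in V(G)\}\!\!\})_{j\in J(\alpha)}\bigr)$; $\operatorname{owl\text{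 - }ref}_{(k_1,0)}(\chi)(\alpha)=\bigl(\chi(\alpha),(\{\!\!\{\chi(\alpha[x_i/w]):w\in V(G)\}\!\!\})_{i\in[k_1]}\bigr)$ and $\operatorname{owl\text{ - }ref}_{(0,k_2)}(\chi)(\alpha)=\bigl(\chi(\alpha),(\{\!\!\{\chi(\alpha[y_j/w]):w\in V(G)\}\!\!\})_{j\in J(\alpha)}\bigr)$ (both still acting on colorings of $\mathcal{A}$). For a refinement operator $R$, $R^{(\infty)}(\chi)$ denotes the coloring obtained by applying $R$ repeatedly until the induced partition no longer changes. $\operatorname{owl}^{(\infty)}_{(k_1,k_2)}(G)=\operatorname{owl\text{ - }ref}^{(\infty)}_{(k_1,k_2)}(\operatorname{atp}_{k_1+k_2}(G))$ and $\operatorname{owl}^{(\infty)}_{(k_1,0)}(G)=\operatorname{owl\text{ - }ref}^{(\infty)}_{(k_1,0)}(\operatorname{atp}_{k_1+k_2}(G))$, both colorings of $\mathcal{A}$. For colorings $\chi,\chi'$ of a set, $\chi\equiv\chi'$ means they induce the same partition into color classes. -}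

module Defs where

open import Level using (0ℓ)
open import Data.Nat using (ℕ; zero; suc; _<_)
open import Data.Fin using (Fin)
open import Data.Fin.Properties using () renaming (_≟_ to _≟ᶠ_)
open import Data.Bool using (Bool; true; false; T)
open import Data.Maybe using (Maybe; just; nothing)
open import Data.List using (List; map; allFin)
open import Data.Sum using (_⊎_; inj₁; inj₂)
open import Data.Sum.Properties using (≡-dec)
open import Data.Product using (_×_; Σ)
open import Relation.Nullary using (¬_; yes; no)
open import Relation.Nullary.Decidable using (⌊_⌋)
open import Relation.Binary using (Setoid; DecidableEquality)
open import Relation.Binary.PropositionalEquality using (_≡_; _→-setoid_)
open import Data.Product.Relation.Binary.Pointwise.NonDependent using (×-setoid)
import Data.Maybe.Relation.Binary.Pointwise as MaybePW
import Data.List.Relation.Binary.Permutation.Setoid as Perm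
import Data.Vec.Functional.Relation.Binary.Equality.Setoid as VecEq

record Graph (n m : ℕ) : Set where
  field
    E     : Fin n → Fin n → Bool
    E-sym : ∀ u v → E u v ≡ E v u
    E-irr : ∀ v → E v v ≡ false
    U     : Fin m → Fin n → Bool

-- Variables [x_k1] ∪ [y_k2] and partial assignments (nothing = ⊥).

Var : ℕ → ℕ → Set
Var k₁ k₂ = Fin k₁ ⊎ Fin k₂

_≟ᵛ_ : ∀ {k₁ k₂} → DecidableEquality (Var k₁ k₂)
_≟ᵛ_ = ≡-dec _≟ᶠ_ _≟ᶠ_

Asg : ℕ → ℕ → ℕ → Set
Asg k₁ k₂ n = Var k₁ k₂ → Maybe (Fin n)

_[_/_] : ∀ {k₁ k₂ n} → Asg k₁ k₂ n → Var k₁ k₂ → Fin n → Asg k₁ k₂ n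
(α [ z / w ]) z' with z' ≟ᵛ z
... | yes _ = just w
... | no  _ = α z'

-- Colorings of 𝒜: a map into a setoid of colors; the induced partition
-- is given by the setoid equality.

record Coloring (A : Set) : Set₁ where
  field
    Col : Setoid 0ℓ 0ℓ
    col : A → Setoid.Carrier Col
  open Setoid Col public using (_≈_)

_≡ₚ_ : ∀ {A} → Coloring A → Coloring A → Set
χ ≡ₚ χ' = ∀ α β → (col χ α ≈₁ col χ β → col χ' α ≈₂ col χ' β)
                × (col χ' α ≈₂ col χ' β → col χ α ≈₁ col χ β)
  where
  open Coloring
  open Setoid (Col χ) renaming (_≈_ to _≈₁_)
  open Setoid (Col χ') renaming (_≈_ to _≈₂_)

data Atom (m k : ℕ) (V : Set) : Set where
  eqA   : V → V → Atom m k V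
  edgeA : V → V → Atom m k V
  colA  : Fin m → V → Atom m k V

-- truth of an atomic formula under α; false unless all its variables
-- lie in dom α
sat : ∀ {n m k₁ k₂} → Graph n m → Asg k₁ k₂ n → Atom m (k₁ Data.Nat.+ k₂) (Var k₁ k₂) → Bool
sat G α (eqA z z') with α z | α z'
... | just v | just w = ⌊ v ≟ᶠ w ⌋
... | _      | _      = false
sat G α (edgeA z z') with α z | α z'
... | just v | just w = Graph.E G v w
... | _      | _      = false
sat G α (colA c z) with α z
... | just v  = Graph.U G c v
... | nothing = false

-- atp_{k1+k2}(G, α), as the characteristic function of the set of
-- satisfied atomic formulas (compared extensionally)
atp : ∀ {n m} k₁ k₂ → Graph n m → Coloring (Asg k₁ k₂ n)
atp {n} {m} k₁ k₂ G = record
  { Col = Atom m (k₁ Data.Nat.+ k₂) (Var k₁ k₂) →-setoid Bool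
  ; col = sat G }

module _ {k₁ k₂ n : ℕ} (χ : Coloring (Asg k₁ k₂ n)) where
  open Coloring χ
  C = Setoid.Carrier Col

  MSet : Setoid 0ℓ 0ℓ
  MSet = Perm.↭-setoid Col

  multi : Asg k₁ k₂ n → Var k₁ k₂ → List C
  multi α z = map (λ w → col (α [ z / w ])) (allFin n)

  XS : Setoid 0ℓ 0ℓ
  XS = VecEq.≋-setoid MSet k₁

  xpart : Asg k₁ k₂ n → Setoid.Carrier XS
  xpart α i = multi α (inj₁ i)

  -- the y-part  (multiset)_{j ∈ J(α)}, encoded as a [k2]-tuple that is
  -- undefined (nothing) exactly outside J(α)
  YS : Setoid 0ℓ 0ℓ
  YS = VecEq.≋-setoid (MaybePW.setoid MSet) k₂

  ypart : Asg k₁ k₂ n → Setoid.Carrier YS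
  ypart α j with α (inj₂ j)
  ... | nothing = just (multi α (inj₂ j))
  ... | just _  = nothing

  owl-ref : Coloring (Asg k₁ k₂ n)
  owl-ref = record
    { Col = ×-setoid Col (×-setoid XS YS)
    ; col = λ α → col α Data.Product., (xpart α Data.Product., ypart α) }

  owl-refX : Coloring (Asg k₁ k₂ n)
  owl-refX = record
    { Col = ×-setoid Col XS
    ; col = λ α → col α Data.Product., xpart α }

  owl-refY : Coloring (Asg k₁ k₂ n)
  owl-refY = record
    { Col = ×-setoid Col YS
    ; col = λ α → col α Data.Product., ypart α }

iter : ∀ {A : Set} → (Coloring A → Coloring A) → ℕ → Coloring A → Coloring A
iter R zero    χ = χ
iter R (suc t) χ = R (iter R t χ)

-- "ψ = R^{(∞)}(χ)": ψ is R^{(s)}(χ) for the least s at which applying R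
-- no longer changes the induced partition.
IsStab : ∀ {A : Set} → (Coloring A → Coloring A) → Coloring A → Coloring A → Set₁
IsStab R χ ψ = Σ ℕ λ s →
    (ψ ≡ iter R s χ)
  × (R (iter R s χ) ≡ₚ iter R s χ)
  × (∀ t → t < s → ¬ (R (iter R t χ) ≡ₚ iter R t χ))

IterStabComp : ∀ {A : Set} → (Coloring A → Coloring A) → (Coloring A → Coloring A)
             → ℕ → Coloring A → Coloring A → Set₁
IterStabComp R Q zero    χ ψ = χ ≡ ψ
IterStabComp R Q (suc t) χ ψ =
  Σ (Coloring _) λ χ' → IsStab R (Q χ) χ' × IterStabComp R Q t χ' ψ

-- Write χ ⪯ χ′ when χ refines χ′. L = owl∞ is the coarsest owl-ref-stable coloring refining
-- atp, and each stage κ of the iteration is the coarsest owl-refX-stable coloring refining atp,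
-- resp. owl-refY of the previous stage; since the operators are monotone, L ⪯ κ throughout.
-- Conversely, let the level of α be its number of undefined y-variables. By induction on t,
-- κₜ-equivalence implies L-equivalence at level ≤ t: glue L together with κₜ restricted to
-- level ≤ t. The result refines atp and is owl-ref-stable (x-multisets by owl-refX-stability of
-- κₜ, as x-updates keep the level; y-multisets by κₜ ⪯ owl-refY κₜ₋₁, as updating an undefined
-- y lowers the level, where the induction hypothesis applies), hence refines L.
-- As no level exceeds k₂, the stage κ_{k₂} and L induce the same partition.
module Submission where

open import Defs
open import Data.Nat using (ℕ; zero; suc; _+_; _≤_; _<_; z≤n)
open import Data.Fin using (Fin)

open import Level using (0ℓ)
open import Data.Bool using (true; not)
open import Data.Fin.Subset using (Subset; ∣_∣; _∈_; _⊂_)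
open import Data.Fin.Subset.Properties using (∣p∣≤n; p⊂q⇒∣p∣<∣q∣; x∈p⇒∣p-x∣<∣p∣)
open import Data.List using (List; []; _∷_; _++_; map; allFin)
open import Data.List.Properties using (map-++)
open import Data.List.Membership.Propositional using (find)
open import Data.List.Membership.Propositional.Properties using (∈-∃++)
open import Data.List.Relation.Unary.Any using (here)
open import Data.List.Relation.Unary.Any.Properties using (map⁻)
open import Data.Maybe using (Maybe; just; nothing; is-just; is-nothing)
open import Data.Nat.Properties using (≤-pred; ≤-trans; <⇒≱; ≤-<-trans; +-suc; +-identityʳ)
open import Data.Product using (_×_; _,_; proj₁; proj₂)
open import Data.Sum using (_⊎_; inj₁; inj₂)
open import Data.Vec using (tabulate)
open import Data.Vec.Properties using (lookup∘tabulate; lookup⇒[]=; []=⇒lookup; tabulate-cong)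
open import Data.Fin.Properties using () renaming (_≟_ to _≟ᶠ_)
open import Relation.Binary using (Setoid)
open import Relation.Binary.PropositionalEquality
  using (_≡_; refl; sym; trans; cong; subst; module ≡-Reasoning)
open import Relation.Nullary using (yes; no; contradiction)
import Data.List.Relation.Binary.Permutation.Setoid as Perm
import Data.Maybe.Relation.Binary.Pointwise as MaybePW
import Data.List.Relation.Binary.Permutation.Setoid.Properties as PermProp

module _ {I : Set} where

  map-↭-shift : (S : Setoid 0ℓ 0ℓ) (h : I → Setoid.Carrier S) (ys : List I) (b : I) (zs : List I) →
    Perm._↭_ S (map h (ys ++ b ∷ zs)) (h b ∷ map h (ys ++ zs))
  map-↭-shift S h ys b zs rewrite map-++ h ys (b ∷ zs) | map-++ h ys zs =
    PermProp.↭-shift S (map h ys) (map h zs)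

  ↭-map-transfer : (S T : Setoid 0ℓ 0ℓ)
    {f f′ : I → Setoid.Carrier S} {g g′ : I → Setoid.Carrier T} →
    (∀ a b → Setoid._≈_ S (f a) (f′ b) → Setoid._≈_ T (g a) (g′ b)) →
    ∀ as bs → Perm._↭_ S (map f as) (map f′ bs) → Perm._↭_ T (map g as) (map g′ bs)
  ↭-map-transfer S T r [] [] _ = Perm.↭-refl T
  ↭-map-transfer S T r [] (b ∷ bs) p = contradiction (Perm.↭-sym S p) (PermProp.¬x∷xs↭[] S)
  ↭-map-transfer S T {f} {f′} {g} {g′} r (a ∷ as) bs p
    with b , b∈bs , fa≈f′b ← find (map⁻ (PermProp.∈-resp-↭ S p (here (Setoid.refl S))))
    with ys , zs , refl ← ∈-∃++ b∈bs
    = Perm.↭-trans T (Perm.prep (r a b fa≈f′b) (↭-map-transfer S T r as (ys ++ zs) rest))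
                     (Perm.↭-sym T (map-↭-shift T g′ ys b zs))
    where
    rest : Perm._↭_ S (map f as) (map f′ (ys ++ zs))
    rest = PermProp.drop-∷ S (Perm.↭-trans S p (Perm.↭-trans S (map-↭-shift S f′ ys b zs)
             (Perm.prep (Setoid.sym S fa≈f′b) (Perm.↭-refl S))))

module _ {A : Set} where

  Ker : Coloring A → A → A → Set
  Ker χ α β = Coloring._≈_ χ (Coloring.col χ α) (Coloring.col χ β)

  infix 4 _⪯_
  _⪯_ : Coloring A → Coloring A → Set
  χ ⪯ χ′ = ∀ α β → Ker χ α β → Ker χ′ α β

  Monotone : (Coloring A → Coloring A) → Set₁
  Monotone R = ∀ χ χ′ → χ ⪯ χ′ → R χ ⪯ R χ′

  Refining : (Coloring A → Coloring A) → Set₁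
  Refining R = ∀ χ → R χ ⪯ χ

  iter-⪯ : ∀ {R} → Refining R → ∀ s χ → iter R s χ ⪯ χ
  iter-⪯ R-ref zero    χ α β e = e
  iter-⪯ R-ref (suc s) χ α β e = iter-⪯ R-ref s χ α β (R-ref _ α β e)

  ⪯-iter : ∀ {R σ χ} → Monotone R → σ ⪯ R σ → σ ⪯ χ → ∀ s → σ ⪯ iter R s χ
  ⪯-iter R-mono σ-stable σ⪯χ zero          = σ⪯χ
  ⪯-iter {R} {σ} {χ} R-mono σ-stable σ⪯χ (suc s) α β e =
    R-mono σ (iter R s χ) (⪯-iter R-mono σ-stable σ⪯χ s) α β (σ-stable α β e)

  IsStab⇒stable : ∀ {R χ ψ} → IsStab R χ ψ → ψ ⪯ R ψ
  IsStab⇒stable (s , refl , stable , _) α β = proj₂ (stable α β)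

  IsStab⇒refines : ∀ {R χ ψ} → IsStab R χ ψ → Refining R → ψ ⪯ χ
  IsStab⇒refines (s , refl , _) R-ref = iter-⪯ R-ref s _

  IsStab⇒coarsest : ∀ {R χ ψ} → IsStab R χ ψ → Monotone R → ∀ σ → σ ⪯ R σ → σ ⪯ χ → σ ⪯ ψ
  IsStab⇒coarsest (s , refl , _) R-mono σ σ-stable σ⪯χ = ⪯-iter R-mono σ-stable σ⪯χ s

  glue : (L κ : Coloring A) → L ⪯ κ → (P : A → Set) → (∀ α β → Ker κ α β → P α → P β) → Coloring A
  glue L κ L⪯κ P P-resp = record
    { Col = record
      { Carrier = A
      ; _≈_ = _≈ᵍ_
      ; isEquivalence = record { refl = inj₁ L.refl ; sym = ≈ᵍ-sym ; trans = ≈ᵍ-trans } }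
    ; col = λ α → α }
    where
    module L = Setoid (Coloring.Col L)
    module κ = Setoid (Coloring.Col κ)

    _≈ᵍ_ : A → A → Set
    α ≈ᵍ β = Ker L α β ⊎ (P α × Ker κ α β)

    ≈ᵍ-sym : ∀ {α β} → α ≈ᵍ β → β ≈ᵍ α
    ≈ᵍ-sym (inj₁ e)       = inj₁ (L.sym e)
    ≈ᵍ-sym (inj₂ (p , e)) = inj₂ (P-resp _ _ e p , κ.sym e)

    ≈ᵍ-trans : ∀ {α β γ} → α ≈ᵍ β → β ≈ᵍ γ → α ≈ᵍ γ
    ≈ᵍ-trans (inj₁ e) (inj₁ e′)                = inj₁ (L.trans e e′)
    ≈ᵍ-trans (inj₁ e) (inj₂ (p , e′))          =
      inj₂ (P-resp _ _ (κ.sym (L⪯κ _ _ e)) p , κ.trans (L⪯κ _ _ e) e′)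
    ≈ᵍ-trans (inj₂ (p , e)) (inj₁ e′)          = inj₂ (p , κ.trans e (L⪯κ _ _ e′))
    ≈ᵍ-trans (inj₂ (p , e)) (inj₂ (_ , e′))    = inj₂ (p , κ.trans e e′)

module _ {k₁ k₂ n : ℕ} where

  private
    𝒜 : Set
    𝒜 = Asg k₁ k₂ n

  XPartEq : Coloring 𝒜 → 𝒜 → 𝒜 → Set
  XPartEq χ α β = Setoid._≈_ (XS χ) (xpart χ α) (xpart χ β)

  YPartEq : Coloring 𝒜 → 𝒜 → 𝒜 → Set
  YPartEq χ α β = Setoid._≈_ (YS χ) (ypart χ α) (ypart χ β)

  KerTransferAt : Coloring 𝒜 → Coloring 𝒜 → 𝒜 → 𝒜 → Var k₁ k₂ → Set
  KerTransferAt χ χ′ α β z = ∀ w w′ → Ker χ (α [ z / w ]) (β [ z / w′ ]) → Ker χ′ (α [ z / w ]) (β [ z / w′ ])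

  multi-transfer : ∀ (χ χ′ : Coloring 𝒜) α β z → KerTransferAt χ χ′ α β z →
    Perm._↭_ (Coloring.Col χ) (multi χ α z) (multi χ β z) →
    Perm._↭_ (Coloring.Col χ′) (multi χ′ α z) (multi χ′ β z)
  multi-transfer χ χ′ α β z r =
    ↭-map-transfer (Coloring.Col χ) (Coloring.Col χ′) r (allFin n) (allFin n)

  xpart-transfer : ∀ (χ χ′ : Coloring 𝒜) α β →
    (∀ i → KerTransferAt χ χ′ α β (inj₁ i)) →
    XPartEq χ α β → XPartEq χ′ α β
  xpart-transfer χ χ′ α β r x i = multi-transfer χ χ′ α β (inj₁ i) (r i) (x i)

  ypart-transfer : ∀ (χ χ′ : Coloring 𝒜) α β →
    (∀ j → α (inj₂ j) ≡ nothing → KerTransferAt χ χ′ α β (inj₂ j)) →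
    YPartEq χ α β → YPartEq χ′ α β
  ypart-transfer χ χ′ α β r y j with α (inj₂ j) in α-j | β (inj₂ j) | y j
  ... | nothing | nothing | MaybePW.just e =
    MaybePW.just (multi-transfer χ χ′ α β (inj₂ j) (r j α-j) e)
  ... | just _  | just _  | MaybePW.nothing = MaybePW.nothing

  owl-refX-monotone : Monotone (owl-refX {k₁} {k₂} {n})
  owl-refX-monotone χ χ′ χ⪯χ′ α β (e , x) =
    χ⪯χ′ α β e , xpart-transfer χ χ′ α β (λ _ _ _ → χ⪯χ′ _ _) x

  owl-refY-monotone : Monotone (owl-refY {k₁} {k₂} {n})
  owl-refY-monotone χ χ′ χ⪯χ′ α β (e , y) =
    χ⪯χ′ α β e , ypart-transfer χ χ′ α β (λ _ _ _ _ → χ⪯χ′ _ _) y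

  owl-ref-monotone : Monotone (owl-ref {k₁} {k₂} {n})
  owl-ref-monotone χ χ′ χ⪯χ′ α β (e , x , y) =
      χ⪯χ′ α β e
    , xpart-transfer χ χ′ α β (λ _ _ _ → χ⪯χ′ _ _) x
    , ypart-transfer χ χ′ α β (λ _ _ _ _ → χ⪯χ′ _ _) y

  owl-refX-refining : Refining (owl-refX {k₁} {k₂} {n})
  owl-refX-refining χ α β = proj₁

  owl-ref-refining : Refining (owl-ref {k₁} {k₂} {n})
  owl-ref-refining χ α β = proj₁

  update-self : ∀ (α : 𝒜) z w → (α [ z / w ]) z ≡ just w
  update-self α z w with z ≟ᵛ z
  ... | yes _  = refl
  ... | no z≢z = contradiction refl z≢z

  update≡nothing⇒≡nothing : ∀ (α : 𝒜) z w z′ → (α [ z / w ]) z′ ≡ nothing → α z′ ≡ nothing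
  update≡nothing⇒≡nothing α z w z′ with z′ ≟ᵛ z
  ... | yes _ = λ ()
  ... | no  _ = λ eq → eq

  undefinedY : 𝒜 → Subset k₂
  undefinedY α = tabulate (λ j → is-nothing (α (inj₂ j)))

  level : 𝒜 → ℕ
  level α = ∣ undefinedY α ∣

  ∈-undefinedY⁺ : ∀ (α : 𝒜) {j} → α (inj₂ j) ≡ nothing → j ∈ undefinedY α
  ∈-undefinedY⁺ α {j} α-j = lookup⇒[]= j _ (trans (lookup∘tabulate _ j) (cong is-nothing α-j))

  ∈-undefinedY⁻ : ∀ (α : 𝒜) {j} → j ∈ undefinedY α → α (inj₂ j) ≡ nothing
  ∈-undefinedY⁻ α {j} j∈ = is-nothing⇒≡nothing (trans (sym (lookup∘tabulate _ j)) ([]=⇒lookup j∈))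
    where
    is-nothing⇒≡nothing : ∀ {m : Maybe (Fin n)} → is-nothing m ≡ true → m ≡ nothing
    is-nothing⇒≡nothing {nothing} _ = refl

  level-cong : ∀ {α β : 𝒜} → (∀ j → is-nothing (α (inj₂ j)) ≡ is-nothing (β (inj₂ j))) →
    level α ≡ level β
  level-cong eq = cong ∣_∣ (tabulate-cong eq)

  undefinedY-y-update-⊂ : ∀ (α : 𝒜) {j} w → α (inj₂ j) ≡ nothing →
    undefinedY (α [ inj₂ j / w ]) ⊂ undefinedY α
  undefinedY-y-update-⊂ α {j} w α-j =
      (λ j′∈ → ∈-undefinedY⁺ α (update≡nothing⇒≡nothing α (inj₂ j) w _ (∈-undefinedY⁻ α′ j′∈)))
    , j , ∈-undefinedY⁺ α α-j
    , λ j∈ → contradiction (trans (sym (update-self α (inj₂ j) w)) (∈-undefinedY⁻ α′ j∈)) λ ()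
    where
    α′ : 𝒜
    α′ = α [ inj₂ j / w ]

  level-y-update-< : ∀ (α : 𝒜) {j} w → α (inj₂ j) ≡ nothing → level (α [ inj₂ j / w ]) < level α
  level-y-update-< α w α-j = p⊂q⇒∣p∣<∣q∣ (undefinedY-y-update-⊂ α w α-j)

  undefined⇒0<level : ∀ (α : 𝒜) {j} → α (inj₂ j) ≡ nothing → 0 < level α
  undefined⇒0<level α α-j = ≤-<-trans z≤n (x∈p⇒∣p-x∣<∣p∣ (∈-undefinedY⁺ α α-j))

module _ {k₁ k₂ n m : ℕ} (G : Graph n m) (L : Coloring (Asg k₁ k₂ n))
         (L-stab : IsStab owl-ref (atp k₁ k₂ G) L) where

  private
    𝒜 : Set
    𝒜 = Asg k₁ k₂ n

    Atp : Coloring 𝒜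
    Atp = atp k₁ k₂ G

  sat-eqA-self : ∀ (α : 𝒜) z → sat G α (eqA z z) ≡ is-just (α z)
  sat-eqA-self α z with α z
  ... | nothing = refl
  ... | just v with v ≟ᶠ v
  ...   | yes _   = refl
  ...   | no v≢v = contradiction refl v≢v

  ⪯atp⇒level≡ : ∀ {κ} → κ ⪯ Atp → ∀ α β → Ker κ α β → level α ≡ level β
  ⪯atp⇒level≡ κ⪯atp α β e = level-cong {α = α} {β = β} λ j → cong not (begin
    is-just (α (inj₂ j))         ≡⟨ sat-eqA-self α (inj₂ j) ⟨
    sat G α (eqA (inj₂ j) (inj₂ j)) ≡⟨ κ⪯atp α β e (eqA (inj₂ j) (inj₂ j)) ⟩
    sat G β (eqA (inj₂ j) (inj₂ j)) ≡⟨ sat-eqA-self β (inj₂ j) ⟩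
    is-just (β (inj₂ j))         ∎)
    where open ≡-Reasoning

  L⪯owl-ref : L ⪯ owl-ref L
  L⪯owl-ref = IsStab⇒stable L-stab

  L⪯atp : L ⪯ Atp
  L⪯atp = IsStab⇒refines L-stab owl-ref-refining

  L⪯owl-refX : L ⪯ owl-refX L
  L⪯owl-refX α β e = let c , x , _ = L⪯owl-ref α β e in c , x

  L⪯owl-refY : L ⪯ owl-refY L
  L⪯owl-refY α β e = let c , _ , y = L⪯owl-ref α β e in c , y

  record Approximation (κ : Coloring 𝒜) (t : ℕ) : Set where
    field
      x-stable : κ ⪯ owl-refX κ
      L⪯κ      : L ⪯ κ
      κ⪯atp    : κ ⪯ Atp
      agrees   : ∀ α β → level α ≤ t → Ker κ α β → Ker L α β

  glue-below : ∀ κ → L ⪯ κ → κ ⪯ Atp → ℕ → Coloring 𝒜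
  glue-below κ L⪯κ κ⪯atp t =
    glue L κ L⪯κ (λ α → level α ≤ t) (λ α β e → subst (_≤ t) (⪯atp⇒level≡ {κ} κ⪯atp α β e))

  agrees-below : ∀ κ (L⪯κ : L ⪯ κ) (κ⪯atp : κ ⪯ Atp) t → κ ⪯ owl-refX κ →
    (∀ α β → level α ≤ t → Ker κ α β → YPartEq (glue-below κ L⪯κ κ⪯atp t) α β) →
    ∀ α β → level α ≤ t → Ker κ α β → Ker L α β
  agrees-below κ L⪯κ κ⪯atp t κ-x-stable y-agree α β l e =
    IsStab⇒coarsest L-stab owl-ref-monotone σ σ-stable σ⪯atp α β (inj₂ (l , e))
    where
    σ : Coloring 𝒜
    σ = glue-below κ L⪯κ κ⪯atp t

    σ-stable : σ ⪯ owl-ref σ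
    σ-stable α β (inj₁ e) =
      let _ , x , y = L⪯owl-ref α β e
      in inj₁ e
       , xpart-transfer L σ α β (λ _ _ _ → inj₁) x
       , ypart-transfer L σ α β (λ _ _ _ _ → inj₁) y
    σ-stable α β (inj₂ (l , e)) =
      -- an x-update has, definitionally, the same level as α
      inj₂ (l , e)
      , xpart-transfer κ σ α β (λ _ _ _ e′ → inj₂ (l , e′)) (proj₂ (κ-x-stable α β e))
      , y-agree α β l e

    σ⪯atp : σ ⪯ Atp
    σ⪯atp α β (inj₁ e)       = L⪯atp α β e
    σ⪯atp α β (inj₂ (_ , e)) = κ⪯atp α β e

  approximation₀ : ∀ {χ₀} → IsStab owl-refX Atp χ₀ → Approximation χ₀ 0
  approximation₀ {χ₀} χ₀-stab = record
    { x-stable = x-stable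
    ; L⪯κ      = L⪯χ₀
    ; κ⪯atp    = χ₀⪯atp
    ; agrees   = agrees-below χ₀ L⪯χ₀ χ₀⪯atp 0 x-stable y-agree }
    where
    x-stable : χ₀ ⪯ owl-refX χ₀
    x-stable = IsStab⇒stable χ₀-stab

    χ₀⪯atp : χ₀ ⪯ Atp
    χ₀⪯atp = IsStab⇒refines χ₀-stab owl-refX-refining

    L⪯χ₀ : L ⪯ χ₀
    L⪯χ₀ = IsStab⇒coarsest χ₀-stab owl-refX-monotone L L⪯owl-refX L⪯atp

    y-agree : ∀ α β → level α ≤ 0 → Ker χ₀ α β → YPartEq (glue-below χ₀ L⪯χ₀ χ₀⪯atp 0) α β
    y-agree α β l e j with α (inj₂ j) in α-j | β (inj₂ j) in β-j
    ... | nothing | _       = contradiction l (<⇒≱ (undefined⇒0<level α α-j))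
    ... | just _  | nothing =
      contradiction (subst (_≤ 0) (⪯atp⇒level≡ {χ₀} χ₀⪯atp α β e) l) (<⇒≱ (undefined⇒0<level β β-j))
    ... | just _  | just _  = MaybePW.nothing

  approximation-step : ∀ {κ κ′ t} → Approximation κ t → IsStab owl-refX (owl-refY κ) κ′ →
    Approximation κ′ (suc t)
  approximation-step {κ} {κ′} {t} κ-approx κ′-stab = record
    { x-stable = x-stable
    ; L⪯κ      = L⪯κ′
    ; κ⪯atp    = κ′⪯atp
    ; agrees   = agrees-below κ′ L⪯κ′ κ′⪯atp (suc t) x-stable y-agree }
    where
    open Approximation κ-approx using (L⪯κ; κ⪯atp; agrees)

    x-stable : κ′ ⪯ owl-refX κ′
    x-stable = IsStab⇒stable κ′-stab

    κ′⪯owl-refY : κ′ ⪯ owl-refY κ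
    κ′⪯owl-refY = IsStab⇒refines κ′-stab owl-refX-refining

    κ′⪯atp : κ′ ⪯ Atp
    κ′⪯atp α β e = κ⪯atp α β (proj₁ (κ′⪯owl-refY α β e))

    L⪯κ′ : L ⪯ κ′
    L⪯κ′ = IsStab⇒coarsest κ′-stab owl-refX-monotone L L⪯owl-refX
             (λ α β e → owl-refY-monotone L κ L⪯κ α β (L⪯owl-refY α β e))

    y-agree : ∀ α β → level α ≤ suc t → Ker κ′ α β → YPartEq (glue-below κ′ L⪯κ′ κ′⪯atp (suc t)) α β
    y-agree α β l e = ypart-transfer κ _ α β
      (λ j α-j w w′ e′ → inj₁ (agrees _ _ (≤-pred (≤-trans (level-y-update-< α w α-j) l)) e′))
      (proj₂ (κ′⪯owl-refY α β e))

  approximation-iter : ∀ {κ ψ t} u → Approximation κ t → IterStabComp owl-refX owl-refY u κ ψ →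
    Approximation ψ (t + u)
  approximation-iter {t = t} zero κ-approx refl =
    subst (Approximation _) (sym (+-identityʳ t)) κ-approx
  approximation-iter {t = t} (suc u) κ-approx (κ′ , κ′-stab , rest) =
    subst (Approximation _) (sym (+-suc t u))
      (approximation-iter u (approximation-step κ-approx κ′-stab) rest)

lemma21 : (k₁ k₂ : ℕ) → 1 ≤ k₁ + k₂ →
    ∀ {n m} (G : Graph n m) →
    (L : Coloring (Asg k₁ k₂ n)) →
    IsStab owl-ref (atp k₁ k₂ G) L →
    (χ₀ : Coloring (Asg k₁ k₂ n)) →
    IsStab owl-refX (atp k₁ k₂ G) χ₀ →
    (ψ : Coloring (Asg k₁ k₂ n)) →
    IterStabComp owl-refX owl-refY k₂ χ₀ ψ →
    L ≡ₚ ψ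
lemma21 k₁ k₂ _ G L L-stab χ₀ χ₀-stab ψ ψ-iter α β = L⪯κ α β , agrees α β (∣p∣≤n (undefinedY α))
  where
  open Approximation (approximation-iter G L L-stab k₂ (approximation₀ G L L-stab χ₀-stab) ψ-iter)
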